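{- Let $k,l\ge1$ and $1\le r\le 2k(2l+1)$. The number of equivalence classes of $\mathcal{B}(2k,2l+1;r)$ under $G=\{R_0,H,V,R_{180}\}$ is \[\frac14\left(\binom{2k(2l+1)}{r}+2\binom{k(2l+1)}{r/2}+\sum_{t=0}^{r}\binom{2k}{t}\binom{2kl}{(r-t)/2}\right).\]
   Context: $\mathcal{B}(2k,2l+1;r)$ is the set of all grids with $2k$ rows and $2l+1$ columns having exactly $r$ blocked cells. $G$ acts by the identity $R_0$, the reflections $H,V$ across the horizontal and vertical midlines, and the rotation $R_{180}$ by 180 degrees; two boards are equivalent if one is an image of the other. Convention: $\binom{a}{b}=0$ when $b$ is not a nonnegative integer or $b>a$. -}

module Defs where

open import Data.Nat using (ℕ; zero; suc; _+_; _*_; _∸_; _/_)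
open import Data.Nat.Combinatorics using (_C_)
open import Data.Nat.Divisibility using (_∣?_)
open import Data.Bool using (Bool; true; false; if_then_else_)
open import Data.Fin using (Fin; opposite)
open import Data.Product using (Σ; _×_; _,_)
open import Data.Sum using (_⊎_)
open import Relation.Nullary.Decidable using (does)
open import Relation.Binary.PropositionalEquality using (_≡_)

sumFin : (n : ℕ) → (Fin n → ℕ) → ℕ
sumFin zero    f = 0
sumFin (suc n) f = f Fin.zero + sumFin n (λ i → f (Fin.suc i))

sumTo : ℕ → (ℕ → ℕ) → ℕ
sumTo zero    f = f 0
sumTo (suc n) f = sumTo n f + f (suc n)

-- A grid with m rows and n columns; true = blocked cell
Grid : ℕ → ℕ → Set
Grid m n = Fin m → Fin n → Bool

blockedCount : {m n : ℕ} → Grid m n → ℕ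
blockedCount {m} {n} b = sumFin m (λ i → sumFin n (λ j → if b i j then 1 else 0))

Board : ℕ → ℕ → ℕ → Set
Board m n r = Σ (Grid m n) (λ b → blockedCount b ≡ r)

R0 Hf Vf R180 : {m n : ℕ} → Grid m n → Grid m n
R0   b i j = b i j
Hf   b i j = b (opposite i) j
Vf   b i j = b i (opposite j)
R180 b i j = b (opposite i) (opposite j)

_≐_ : {m n : ℕ} → Grid m n → Grid m n → Set
b ≐ c = ∀ i j → b i j ≡ c i j

_∼_ : {m n r : ℕ} → Board m n r → Board m n r → Set
(b , _) ∼ (c , _) = (c ≐ R0 b) ⊎ ((c ≐ Hf b) ⊎ ((c ≐ Vf b) ⊎ (c ≐ R180 b)))

HasNumClasses : {A : Set} → (A → A → Set) → ℕ → Set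
HasNumClasses {A} _≈_ N =
  Σ (A → Fin N) (λ cls →
    (∀ x y → (cls x ≡ cls y → x ≈ y) × (x ≈ y → cls x ≡ cls y))
    × (∀ (c : Fin N) → Σ A (λ x → cls x ≡ c)))

-- binom a (q / 2) with the convention that it is 0 when q is odd
halfBinom : ℕ → ℕ → ℕ
halfBinom a q = if does (2 ∣? q) then a C (q / 2) else 0

{-# OPTIONS --safe #-}

-- Burnside's lemma for G: four times the number of classes is the sum over g ∈ G of the
-- number of boards fixed by g.  Each g permutes the cells by an involution, and a board is
-- fixed by g iff its set of blocked cells is a union of cycles of g.  If the involution has f
-- fixed cells and p transpositions, choosing t blocked fixed cells and (r - t)/2 blocked
-- transpositions shows that it fixes ∑ₜ C(f, t) C(p, (r - t)/2) boards.  R₀ has f = 2k(2l+1);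
-- H and R₁₈₀ have f = 0 and p = k(2l+1); V fixes the 2k cells of the middle column and has
-- p = 2kl.
--
-- For the class map, grids are coded by numbers below 2^(2k(2l+1)), every class is
-- represented by the least code it contains, and a board is sent to the rank of its
-- representative among all representatives.

module Submission where

open import Defs
open import Data.Nat using (ℕ; _+_; _*_; _∸_; _≤_; _/_)
open import Data.Nat.Combinatorics using (_C_)
open import Relation.Binary.PropositionalEquality using (_≡_)
open import Data.Product using (Σ; _×_)

open import Data.Nat using (zero; suc; _^_; _<_; _≤?_; z≤n; s≤s; s≤s⁻¹)
open import Data.Nat.Properties
open import Data.Nat.Combinatorics using (nCk+nC[k+1]≡[n+1]C[k+1]; k>n⇒nCk≡0)
open import Data.Nat.Divisibility using (_∣?_; divides)
open import Data.Nat.DivMod using (m*n/n≡m)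
open import Data.Nat.Solver using (module +-*-Solver)
open import Data.Bool using (Bool; true; false; _∧_; _xor_; if_then_else_; T)
open import Data.Bool.Properties using (xor-same; ∧-identityʳ; T-∧) renaming (_≟_ to _≟ᵇ_)
open import Data.Unit using (tt)
open import Data.Empty using (⊥)
open import Data.Fin using (Fin; toℕ; fromℕ<; combine; remQuot; splitAt; join; _↑ˡ_; _↑ʳ_; opposite)
open import Data.Fin.Properties
  using ( +↔⊎; *↔×; 2↔Bool; remQuot-combine; combine-remQuot; splitAt-join; join-splitAt
        ; splitAt-↑ˡ; splitAt-↑ʳ; opposite-involutive; opposite-prop; toℕ-injective; toℕ-↑ˡ; toℕ-↑ʳ
        ; toℕ<n; toℕ-fromℕ<)
  renaming (_≟_ to _≟ᶠ_)
open import Data.Fin.Permutation using (Permutation; permutation; _⟨$⟩ʳ_; _⟨$⟩ˡ_; inverseˡ; inverseʳ)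
open import Data.Vec using (Vec; []; _∷_; _++_; lookup; tabulate)
open import Data.Vec.Properties
  using (lookup∘tabulate; tabulate∘lookup; tabulate-cong; ≡-dec; lookup-splitAt; ++-injectiveˡ; ++-injectiveʳ)
open import Data.List using (List; []; _∷_)
open import Data.List.Membership.Propositional using (_∈_)
open import Data.List.Relation.Unary.Any using (here; there)
import Data.List.Relation.Unary.All as All
import Data.List.Extrema ≤-totalOrder as Extrema
open import Data.Product using (_,_; proj₁; proj₂; map; uncurry)
open import Data.Product.Function.NonDependent.Propositional using (_×-↔_)
open import Data.Sum using (_⊎_; inj₁; inj₂; [_,_]′; map₂; swap)
open import Data.Sum.Function.Propositional using (_⊎-↔_)
open import Function using (_∘_; _⇔_; mk⇔; Equivalence; Inverse; _↔_; mk↔ₛ′)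
open import Function.Properties.Inverse using (↔-refl; ↔-sym; ↔-trans)
open import Relation.Binary.PropositionalEquality using (refl; sym; trans; cong; cong₂; subst; _≗_; module ≡-Reasoning)
open import Relation.Nullary.Decidable using (Dec; does; yes; no; dec-true; dec-false; does-⇔)
import Algebra.Properties.CommutativeMonoid.Sum as MonoidSum
open import Algebra.Properties.CommutativeSemigroup +-commutativeSemigroup using (interchange)

module ∑ = MonoidSum +-0-commutativeMonoid
open Inverse using (to; from; strictlyInverseˡ; strictlyInverseʳ)
open +-*-Solver using (solve; _:+_; _:*_; _:=_; con)

-- Finite sums

𝟙 : Bool → ℕ
𝟙 b = if b then 1 else 0

𝟙-∧ : ∀ a b → 𝟙 (a ∧ b) ≡ 𝟙 a * 𝟙 b
𝟙-∧ true  b = sym (+-identityʳ (𝟙 b))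
𝟙-∧ false b = refl

T-does : ∀ {A : Set} (a? : Dec A) → T (does a?) ⇔ A
T-does (yes a) = mk⇔ (λ _ → a) (λ _ → tt)
T-does (no ¬a) = mk⇔ (λ ()) ¬a

sumFin≡sum : ∀ n (f : Fin n → ℕ) → sumFin n f ≡ ∑.sum f
sumFin≡sum zero    f = refl
sumFin≡sum (suc n) f = cong (f Fin.zero +_) (sumFin≡sum n (f ∘ Fin.suc))

sumFin-cong : ∀ n {f g : Fin n → ℕ} → f ≗ g → sumFin n f ≡ sumFin n g
sumFin-cong zero    f≗g = refl
sumFin-cong (suc n) f≗g = cong₂ _+_ (f≗g Fin.zero) (sumFin-cong n (f≗g ∘ Fin.suc))

sumFin-distrib-+ : ∀ n (f g : Fin n → ℕ) → sumFin n (λ i → f i + g i) ≡ sumFin n f + sumFin n g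
sumFin-distrib-+ n f g = begin
  sumFin n (λ i → f i + g i)  ≡⟨ sumFin≡sum n _ ⟩
  ∑.sum (λ i → f i + g i)     ≡⟨ ∑.∑-distrib-+ f g ⟩
  ∑.sum f + ∑.sum g           ≡⟨ cong₂ _+_ (sumFin≡sum n f) (sumFin≡sum n g) ⟨
  sumFin n f + sumFin n g     ∎
  where open ≡-Reasoning

sumFin-permute : ∀ {m n} (π : Permutation m n) (f : Fin n → ℕ) → sumFin n f ≡ sumFin m (f ∘ (π ⟨$⟩ʳ_))
sumFin-permute {m} {n} π f = begin
  sumFin n f                ≡⟨ sumFin≡sum n f ⟩
  ∑.sum f                   ≡⟨ ∑.sum-permute f π ⟩
  ∑.sum (f ∘ (π ⟨$⟩ʳ_))     ≡⟨ sumFin≡sum m _ ⟨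
  sumFin m (f ∘ (π ⟨$⟩ʳ_))  ∎
  where open ≡-Reasoning

sumFin-+ : ∀ a b (f : Fin (a + b) → ℕ) →
           sumFin (a + b) f ≡ sumFin a (λ i → f (i ↑ˡ b)) + sumFin b (λ j → f (a ↑ʳ j))
sumFin-+ zero    b f = refl
sumFin-+ (suc a) b f = trans (cong (f Fin.zero +_) (sumFin-+ a b (f ∘ Fin.suc))) (sym (+-assoc (f Fin.zero) _ _))

sumFin-combine : ∀ a b (f : Fin (a * b) → ℕ) →
                 sumFin (a * b) f ≡ sumFin a (λ i → sumFin b (λ j → f (combine i j)))
sumFin-combine zero    b f = refl
sumFin-combine (suc a) b f = trans (sumFin-+ b (a * b) f)
  (cong (sumFin b (λ j → f (j ↑ˡ (a * b))) +_) (sumFin-combine a b (λ x → f (b ↑ʳ x))))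

sumTo-cong : ∀ n {g h : ℕ → ℕ} → (∀ t → t ≤ n → g t ≡ h t) → sumTo n g ≡ sumTo n h
sumTo-cong zero    g≗h = g≗h 0 z≤n
sumTo-cong (suc n) g≗h = cong₂ _+_ (sumTo-cong n (λ t t≤n → g≗h t (m≤n⇒m≤1+n t≤n))) (g≗h (suc n) ≤-refl)

sumTo-distrib-+ : ∀ n (g h : ℕ → ℕ) → sumTo n (λ t → g t + h t) ≡ sumTo n g + sumTo n h
sumTo-distrib-+ zero    g h = refl
sumTo-distrib-+ (suc n) g h = trans (cong (_+ (g (suc n) + h (suc n))) (sumTo-distrib-+ n g h))
                                    (interchange (sumTo n g) (sumTo n h) _ _)

sumTo-suc : ∀ n (g : ℕ → ℕ) → sumTo (suc n) g ≡ g 0 + sumTo n (g ∘ suc)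
sumTo-suc zero    g = refl
sumTo-suc (suc n) g = trans (cong (_+ g (suc (suc n))) (sumTo-suc n g)) (+-assoc (g 0) _ _)

sumTo-extend : ∀ {n} m {g : ℕ → ℕ} → n ≤ m → (∀ t → n < t → g t ≡ 0) → sumTo m g ≡ sumTo n g
sumTo-extend zero    z≤n   _      = refl
sumTo-extend (suc m) n≤1+m vanish with m≤n⇒m<n∨m≡n n≤1+m
... | inj₂ refl  = refl
... | inj₁ n<1+m = trans (cong₂ _+_ (sumTo-extend m (s≤s⁻¹ n<1+m) vanish) (vanish (suc m) n<1+m)) (+-identityʳ _)

sumTo-support : ∀ m n {g : ℕ → ℕ} → (∀ t → m < t → g t ≡ 0) → (∀ t → n < t → g t ≡ 0) →
                sumTo m g ≡ sumTo n g
sumTo-support m n vanishₘ vanishₙ with ≤-total m n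
... | inj₁ m≤n = sym (sumTo-extend n m≤n vanishₘ)
... | inj₂ n≤m = sumTo-extend m n≤m vanishₙ

sumTo-pascal : ∀ f (g : ℕ → ℕ) →
  sumTo f (λ t → (f C t) * g t) + sumTo f (λ t → (f C t) * g (suc t)) ≡ sumTo (suc f) (λ t → (suc f C t) * g t)
sumTo-pascal f g = begin
  sumTo f (λ t → (f C t) * g t) + A        ≡⟨ cong (_+ A) (sumTo-extend (suc f) (n≤1+n f) top-vanishes) ⟨
  sumTo (suc f) (λ t → (f C t) * g t) + A  ≡⟨ cong (_+ A) (sumTo-suc f _) ⟩
  g 0 + 0 + B + A                          ≡⟨ trans (+-assoc (g 0 + 0) B A) (cong (g 0 + 0 +_) (+-comm B A)) ⟩
  g 0 + 0 + (A + B)                        ≡⟨ cong (g 0 + 0 +_) (sumTo-distrib-+ f _ _) ⟨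
  g 0 + 0 + sumTo f (λ t → (f C t) * g (suc t) + (f C suc t) * g (suc t))
                                           ≡⟨ cong (g 0 + 0 +_) (sumTo-cong f (λ t _ → pascal t)) ⟩
  g 0 + 0 + sumTo f (λ t → (suc f C suc t) * g (suc t))
                                           ≡⟨ sumTo-suc f _ ⟨
  sumTo (suc f) (λ t → (suc f C t) * g t)  ∎
  where
  open ≡-Reasoning
  A B : ℕ
  A = sumTo f (λ t → (f C t) * g (suc t))
  B = sumTo f (λ t → (f C suc t) * g (suc t))
  top-vanishes : ∀ t → f < t → (f C t) * g t ≡ 0
  top-vanishes t f<t = cong (_* g t) (k>n⇒nCk≡0 f<t)
  pascal : ∀ t → (f C t) * g (suc t) + (f C suc t) * g (suc t) ≡ (suc f C suc t) * g (suc t)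
  pascal t = trans (sym (*-distribʳ-+ (g (suc t)) (f C t) (f C suc t)))
                   (cong (_* g (suc t)) (nCk+nC[k+1]≡[n+1]C[k+1] f t))

sumTo-0C : ∀ r (g : ℕ → ℕ) → sumTo r (λ t → (0 C t) * g t) ≡ g 0
sumTo-0C zero    g = +-identityʳ (g 0)
sumTo-0C (suc r) g = trans (+-identityʳ _) (sumTo-0C r g)

-- Boolean colourings of Fin n

weight : ∀ {n} → Vec Bool n → ℕ
weight {n} v = sumFin n (λ i → 𝟙 (lookup v i))

weight-++ : ∀ {a b} (u : Vec Bool a) (w : Vec Bool b) → weight (u ++ w) ≡ weight u + weight w
weight-++ []      w = refl
weight-++ (x ∷ u) w = trans (cong (𝟙 x +_) (weight-++ u w)) (sym (+-assoc (𝟙 x) _ _))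

relabel : ∀ {A : Set} {m n} → Vec A n → (Fin m → Fin n) → Vec A m
relabel v τ = tabulate (lookup v ∘ τ)

lookup-relabel : ∀ {A : Set} {m n} (v : Vec A n) (τ : Fin m → Fin n) i → lookup (relabel v τ) i ≡ lookup v (τ i)
lookup-relabel v τ = lookup∘tabulate (lookup v ∘ τ)

lookup-injective : ∀ {A : Set} {n} {u w : Vec A n} → lookup u ≗ lookup w → u ≡ w
lookup-injective {u = u} {w} eq = trans (sym (tabulate∘lookup u)) (trans (tabulate-cong eq) (tabulate∘lookup w))

relabel-id : ∀ {A : Set} {n} (v : Vec A n) → relabel v (λ i → i) ≡ v
relabel-id = tabulate∘lookup

relabel-∘ : ∀ {A : Set} {m n o} (v : Vec A o) (σ : Fin n → Fin o) (τ : Fin m → Fin n) →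
            relabel (relabel v σ) τ ≡ relabel v (σ ∘ τ)
relabel-∘ v σ τ = tabulate-cong (lookup-relabel v σ ∘ τ)

relabel-cong : ∀ {A : Set} {m n} (v : Vec A n) {σ τ : Fin m → Fin n} → σ ≗ τ → relabel v σ ≡ relabel v τ
relabel-cong v σ≗τ = tabulate-cong (cong (lookup v) ∘ σ≗τ)

relabel-inverse : ∀ {A : Set} {m n} (v : Vec A n) (σ : Fin m → Fin n) (τ : Fin n → Fin m) →
                  (∀ i → σ (τ i) ≡ i) → relabel (relabel v σ) τ ≡ v
relabel-inverse v σ τ στ≗id = trans (relabel-∘ v σ τ) (trans (relabel-cong v στ≗id) (relabel-id v))

relabel-injective : ∀ {A : Set} {m n} {u w : Vec A n} (σ : Fin m → Fin n) (τ : Fin n → Fin m) →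
                    (∀ i → σ (τ i) ≡ i) → relabel u σ ≡ relabel w σ → u ≡ w
relabel-injective {u = u} {w} σ τ στ≗id eq =
  trans (sym (relabel-inverse u σ τ στ≗id)) (trans (cong (λ v → relabel v τ) eq) (relabel-inverse w σ τ στ≗id))

weight-relabel : ∀ {m n} (π : Permutation m n) (v : Vec Bool n) → weight (relabel v (π ⟨$⟩ʳ_)) ≡ weight v
weight-relabel {m} {n} π v = begin
  sumFin m (λ i → 𝟙 (lookup (relabel v (π ⟨$⟩ʳ_)) i))  ≡⟨ sumFin-cong m (cong 𝟙 ∘ lookup-relabel v _) ⟩
  sumFin m (λ i → 𝟙 (lookup v (π ⟨$⟩ʳ i)))           ≡⟨ sumFin-permute π _ ⟨
  sumFin n (λ i → 𝟙 (lookup v i))                    ∎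
  where open ≡-Reasoning

infix 4 _≟ᵛ_
_≟ᵛ_ : ∀ {n} (u w : Vec Bool n) → Dec (u ≡ w)
_≟ᵛ_ = ≡-dec _≟ᵇ_

∑ᵛ : ∀ n → (Vec Bool n → ℕ) → ℕ
∑ᵛ zero    G = G []
∑ᵛ (suc n) G = ∑ᵛ n (λ v → G (false ∷ v)) + ∑ᵛ n (λ v → G (true ∷ v))

∑ᵛ-cong : ∀ n {G H : Vec Bool n → ℕ} → (∀ v → G v ≡ H v) → ∑ᵛ n G ≡ ∑ᵛ n H
∑ᵛ-cong zero    G≗H = G≗H []
∑ᵛ-cong (suc n) G≗H = cong₂ _+_ (∑ᵛ-cong n (G≗H ∘ (false ∷_))) (∑ᵛ-cong n (G≗H ∘ (true ∷_)))

∑ᵛ-zero : ∀ n → ∑ᵛ n (λ _ → 0) ≡ 0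
∑ᵛ-zero zero    = refl
∑ᵛ-zero (suc n) = cong₂ _+_ (∑ᵛ-zero n) (∑ᵛ-zero n)

∑ᵛ-++ : ∀ a b (G : Vec Bool (a + b) → ℕ) → ∑ᵛ (a + b) G ≡ ∑ᵛ a (λ u → ∑ᵛ b (λ w → G (u ++ w)))
∑ᵛ-++ zero    b G = refl
∑ᵛ-++ (suc a) b G = cong₂ _+_ (∑ᵛ-++ a b (G ∘ (false ∷_))) (∑ᵛ-++ a b (G ∘ (true ∷_)))

∑ᵛ-diagonal : ∀ {n} (u : Vec Bool n) (G : Vec Bool n → ℕ) → ∑ᵛ n (λ w → 𝟙 (does (u ≟ᵛ w)) * G w) ≡ G u
∑ᵛ-diagonal []                  G = +-identityʳ (G [])
∑ᵛ-diagonal {suc n} (false ∷ u) G = trans (cong₂ _+_ (∑ᵛ-diagonal u (G ∘ (false ∷_))) (∑ᵛ-zero n)) (+-identityʳ _)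
∑ᵛ-diagonal {suc n} (true ∷ u)  G = cong₂ _+_ (∑ᵛ-zero n) (∑ᵛ-diagonal u (G ∘ (true ∷_)))

∑ᵛ-binomial : ∀ n s → ∑ᵛ n (λ v → 𝟙 (does (weight v ≟ s))) ≡ n C s
∑ᵛ-binomial zero    zero    = refl
∑ᵛ-binomial zero    (suc s) = refl
∑ᵛ-binomial (suc n) zero    = trans (cong₂ _+_ (∑ᵛ-binomial n 0) (∑ᵛ-zero n)) (+-identityʳ 1)
∑ᵛ-binomial (suc n) (suc s) = begin
  ∑ᵛ n (λ v → 𝟙 (does (weight v ≟ suc s))) + ∑ᵛ n (λ v → 𝟙 (does (weight v ≟ s)))
                      ≡⟨ cong₂ _+_ (∑ᵛ-binomial n (suc s)) (∑ᵛ-binomial n s) ⟩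
  n C suc s + n C s   ≡⟨ +-comm (n C suc s) (n C s) ⟩
  n C s + n C suc s   ≡⟨ nCk+nC[k+1]≡[n+1]C[k+1] n s ⟩
  suc n C suc s       ∎
  where open ≡-Reasoning

∑ᵛ-double : ∀ p q → ∑ᵛ p (λ d → 𝟙 (does (weight d + weight d ≟ q))) ≡ halfBinom p q
∑ᵛ-double p q with 2 ∣? q
... | yes (divides k refl) = begin
  ∑ᵛ p (λ d → 𝟙 (does (weight d + weight d ≟ k * 2)))
    ≡⟨ ∑ᵛ-cong p (λ d → cong 𝟙 (does-⇔ (halve (weight d)) (weight d + weight d ≟ k * 2) (weight d ≟ k))) ⟩
  ∑ᵛ p (λ d → 𝟙 (does (weight d ≟ k)))  ≡⟨ ∑ᵛ-binomial p k ⟩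
  p C k                                  ≡⟨ cong (p C_) (m*n/n≡m k 2) ⟨
  p C (k * 2 / 2)
    ≡⟨ cong (λ b → if b then p C (k * 2 / 2) else 0) (dec-true (2 ∣? k * 2) (divides k refl)) ⟨
  halfBinom p (k * 2)                    ∎
  where
  open ≡-Reasoning
  halve : ∀ w → (w + w ≡ k * 2) ⇔ (w ≡ k)
  halve w = mk⇔ (λ eq → *-cancelʳ-≡ w k 2 (trans (sym (double w)) eq)) (λ { refl → double k })
    where
    double : ∀ x → x + x ≡ x * 2
    double x = trans (cong (x +_) (sym (+-identityʳ x))) (*-comm 2 x)
... | no 2∤q = begin
  ∑ᵛ p (λ d → 𝟙 (does (weight d + weight d ≟ q)))  ≡⟨ ∑ᵛ-cong p (λ d → cong 𝟙 (dec-false (_ ≟ q) (odd (weight d)))) ⟩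
  ∑ᵛ p (λ _ → 0)                                  ≡⟨ ∑ᵛ-zero p ⟩
  0                                               ≡⟨ cong (λ b → if b then p C (q / 2) else 0) (dec-false (2 ∣? q) 2∤q) ⟨
  halfBinom p q                                   ∎
  where
  open ≡-Reasoning
  odd : ∀ w → w + w ≡ q → ⊥
  odd w eq = 2∤q (divides w (trans (sym eq) (trans (cong (w +_) (sym (+-identityʳ w))) (*-comm 2 w))))

∑ᵛ-offset-double : ∀ p t r →
  ∑ᵛ p (λ d → 𝟙 (does (t + (weight d + weight d) ≟ r))) ≡ 𝟙 (does (t ≤? r)) * halfBinom p (r ∸ t)
∑ᵛ-offset-double p t r with t ≤? r
... | yes t≤r = begin
  ∑ᵛ p (λ d → 𝟙 (does (t + (weight d + weight d) ≟ r)))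
    ≡⟨ ∑ᵛ-cong p (λ d → cong 𝟙 (does-⇔ (subtract-t _) (t + (weight d + weight d) ≟ r) (weight d + weight d ≟ r ∸ t))) ⟩
  ∑ᵛ p (λ d → 𝟙 (does (weight d + weight d ≟ r ∸ t)))  ≡⟨ ∑ᵛ-double p (r ∸ t) ⟩
  halfBinom p (r ∸ t)                                  ≡⟨ *-identityˡ _ ⟨
  1 * halfBinom p (r ∸ t)                              ≡⟨ cong (λ b → 𝟙 b * halfBinom p (r ∸ t)) (dec-true (t ≤? r) t≤r) ⟨
  𝟙 (does (t ≤? r)) * halfBinom p (r ∸ t)              ∎
  where
  open ≡-Reasoning
  subtract-t : ∀ x → (t + x ≡ r) ⇔ (x ≡ r ∸ t)
  subtract-t x = mk⇔ (λ eq → trans (sym (m+n∸m≡n t x)) (cong (_∸ t) eq)) (λ eq → trans (cong (t +_) eq) (m+[n∸m]≡n t≤r))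
... | no t≰r = begin
  ∑ᵛ p (λ d → 𝟙 (does (t + (weight d + weight d) ≟ r)))
    ≡⟨ ∑ᵛ-cong p (λ d → cong 𝟙 (dec-false (_ ≟ r) (λ eq → t≰r (subst (t ≤_) eq (m≤m+n t _))))) ⟩
  ∑ᵛ p (λ _ → 0)                                       ≡⟨ ∑ᵛ-zero p ⟩
  0 * halfBinom p (r ∸ t)                              ≡⟨ cong (λ b → 𝟙 b * halfBinom p (r ∸ t)) (dec-false (t ≤? r) t≰r) ⟨
  𝟙 (does (t ≤? r)) * halfBinom p (r ∸ t)              ∎
  where open ≡-Reasoning

∑ᵛ-weight : ∀ f (h : ℕ → ℕ) → ∑ᵛ f (h ∘ weight) ≡ sumTo f (λ t → (f C t) * h t)
∑ᵛ-weight zero    h = sym (+-identityʳ (h 0))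
∑ᵛ-weight (suc f) h = trans (cong₂ _+_ (∑ᵛ-weight f h) (∑ᵛ-weight f (h ∘ suc))) (sumTo-pascal f h)

toCode : ∀ {n} → Vec Bool n → Fin (2 ^ n)
toCode []      = Fin.zero
toCode (b ∷ v) = combine (from 2↔Bool b) (toCode v)

fromCode : ∀ {n} → Fin (2 ^ n) → Vec Bool n
fromCode {zero}  _ = []
fromCode {suc n} x = to 2↔Bool (proj₁ (remQuot {2} (2 ^ n) x)) ∷ fromCode (proj₂ (remQuot {2} (2 ^ n) x))

fromCode-toCode : ∀ {n} (v : Vec Bool n) → fromCode (toCode v) ≡ v
fromCode-toCode []      = refl
fromCode-toCode {suc n} (b ∷ v) =
  trans (cong (λ p → to 2↔Bool (proj₁ p) ∷ fromCode {n} (proj₂ p)) (remQuot-combine (from 2↔Bool b) (toCode v)))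
        (cong₂ _∷_ (strictlyInverseˡ 2↔Bool b) (fromCode-toCode v))

toCode-fromCode : ∀ {n} (x : Fin (2 ^ n)) → toCode (fromCode {n} x) ≡ x
toCode-fromCode {zero}  Fin.zero = refl
toCode-fromCode {suc n} x = trans (toCode-cons (remQuot {2} (2 ^ n) x)) (combine-remQuot {2} (2 ^ n) x)
  where
  toCode-cons : ∀ p → toCode (to 2↔Bool (proj₁ p) ∷ fromCode {n} (proj₂ p)) ≡ uncurry combine p
  toCode-cons (s , y) = cong₂ combine (strictlyInverseʳ 2↔Bool s) (toCode-fromCode {n} y)

toCode-injective : ∀ {n} {u w : Vec Bool n} → toCode u ≡ toCode w → u ≡ w
toCode-injective {u = u} {w} eq = trans (sym (fromCode-toCode u)) (trans (cong fromCode eq) (fromCode-toCode w))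

∑ᵛ-toCode : ∀ n (F : Fin (2 ^ n) → ℕ) → ∑ᵛ n (F ∘ toCode) ≡ sumFin (2 ^ n) F
∑ᵛ-toCode zero    F = sym (+-identityʳ (F Fin.zero))
∑ᵛ-toCode (suc n) F = begin
  ∑ᵛ n (F ∘ toCode ∘ (false ∷_)) + ∑ᵛ n (F ∘ toCode ∘ (true ∷_))
    ≡⟨ cong₂ _+_ (∑ᵛ-toCode n (F ∘ withBit false)) (∑ᵛ-toCode n (F ∘ withBit true)) ⟩
  sumFin (2 ^ n) (F ∘ withBit false) + sumFin (2 ^ n) (F ∘ withBit true)
    ≡⟨ cong (sumFin (2 ^ n) (F ∘ withBit false) +_) (+-identityʳ _) ⟨
  sumFin 2 (λ s → sumFin (2 ^ n) (F ∘ combine s))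
    ≡⟨ sumFin-combine 2 (2 ^ n) F ⟨
  sumFin (2 ^ suc n) F
    ∎
  where
  open ≡-Reasoning
  withBit : Bool → Fin (2 ^ n) → Fin (2 ^ suc n)
  withBit b = combine (from 2↔Bool b)

codePermutation : ∀ {m n} → Permutation m n → Permutation (2 ^ n) (2 ^ m)
codePermutation {m} {n} π = permutation (relabelCode (π ⟨$⟩ʳ_)) (relabelCode (π ⟨$⟩ˡ_))
  (roundtrip (π ⟨$⟩ˡ_) (π ⟨$⟩ʳ_) (λ _ → inverseˡ π)) (roundtrip (π ⟨$⟩ʳ_) (π ⟨$⟩ˡ_) (λ _ → inverseʳ π))
  where
  relabelCode : ∀ {a b} → (Fin a → Fin b) → Fin (2 ^ b) → Fin (2 ^ a)
  relabelCode τ x = toCode (relabel (fromCode x) τ)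
  roundtrip : ∀ {a b} (σ : Fin a → Fin b) (τ : Fin b → Fin a) → (∀ i → σ (τ i) ≡ i) →
              ∀ x → relabelCode τ (relabelCode σ x) ≡ x
  roundtrip {a} {b} σ τ στ≗id x = begin
    toCode (relabel (fromCode (toCode (relabel (fromCode x) σ))) τ)
      ≡⟨ cong (λ v → toCode (relabel v τ)) (fromCode-toCode (relabel (fromCode x) σ)) ⟩
    toCode (relabel (relabel (fromCode x) σ) τ)  ≡⟨ cong toCode (relabel-inverse (fromCode x) σ τ στ≗id) ⟩
    toCode (fromCode {b} x)                      ≡⟨ toCode-fromCode {b} x ⟩
    x                                            ∎
    where open ≡-Reasoning

∑ᵛ-permute : ∀ {m n} (π : Permutation m n) (G : Vec Bool m → ℕ) → ∑ᵛ m G ≡ ∑ᵛ n (λ v → G (relabel v (π ⟨$⟩ʳ_)))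
∑ᵛ-permute {m} {n} π G = begin
  ∑ᵛ m G                                        ≡⟨ ∑ᵛ-cong m (cong G ∘ fromCode-toCode) ⟨
  ∑ᵛ m (G ∘ fromCode ∘ toCode)                  ≡⟨ ∑ᵛ-toCode m (G ∘ fromCode) ⟩
  sumFin (2 ^ m) (G ∘ fromCode)                 ≡⟨ sumFin-permute Π (G ∘ fromCode) ⟩
  sumFin (2 ^ n) (G ∘ fromCode ∘ (Π ⟨$⟩ʳ_))     ≡⟨ ∑ᵛ-toCode n _ ⟨
  ∑ᵛ n (G ∘ fromCode ∘ (Π ⟨$⟩ʳ_) ∘ toCode)      ≡⟨ ∑ᵛ-cong n (cong G ∘ decode) ⟩
  ∑ᵛ n (λ v → G (relabel v (π ⟨$⟩ʳ_)))          ∎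
  where
  open ≡-Reasoning
  Π : Permutation (2 ^ n) (2 ^ m)
  Π = codePermutation π
  decode : ∀ v → fromCode (toCode (relabel (fromCode (toCode v)) (π ⟨$⟩ʳ_))) ≡ relabel v (π ⟨$⟩ʳ_)
  decode v = trans (fromCode-toCode _) (cong (λ w → relabel w (π ⟨$⟩ʳ_)) (fromCode-toCode v))

-- Colourings invariant under an involution

invariantColourings : ∀ n → (Fin n → Fin n) → ℕ → ℕ
invariantColourings n σ r = ∑ᵛ n (λ v → 𝟙 (does (weight v ≟ r) ∧ does (relabel v σ ≟ᵛ v)))

invariantColourings-id : ∀ n {σ : Fin n → Fin n} → (∀ x → σ x ≡ x) → ∀ r → invariantColourings n σ r ≡ n C r
invariantColourings-id n {σ} σ≗id r = trans (∑ᵛ-cong n always-fixed) (∑ᵛ-binomial n r)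
  where
  always-fixed : ∀ v → 𝟙 (does (weight v ≟ r) ∧ does (relabel v σ ≟ᵛ v)) ≡ 𝟙 (does (weight v ≟ r))
  always-fixed v = cong 𝟙 (trans (cong (does (weight v ≟ r) ∧_) (dec-true (relabel v σ ≟ᵛ v) fixed)) (∧-identityʳ _))
    where
    fixed : relabel v σ ≡ v
    fixed = trans (relabel-cong v σ≗id) (relabel-id v)

invariantColourings-conj : ∀ {m n} (π : Permutation m n) (σ : Fin m → Fin m) (τ : Fin n → Fin n) →
  (∀ x → π ⟨$⟩ʳ σ x ≡ τ (π ⟨$⟩ʳ x)) → ∀ r → invariantColourings m σ r ≡ invariantColourings n τ r
invariantColourings-conj {m} {n} π σ τ πσ≡τπ r = trans (∑ᵛ-permute π _) (∑ᵛ-cong n (λ v →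
  cong₂ (λ a b → 𝟙 (a ∧ b)) (cong (λ w → does (w ≟ r)) (weight-relabel π v))
                            (does-⇔ (fixed⇔ v) (relabel (relabel v (π ⟨$⟩ʳ_)) σ ≟ᵛ _) (relabel v τ ≟ᵛ v))))
  where
  relabel-σ : ∀ v → relabel (relabel v (π ⟨$⟩ʳ_)) σ ≡ relabel (relabel v τ) (π ⟨$⟩ʳ_)
  relabel-σ v = trans (relabel-∘ v _ σ) (trans (relabel-cong v πσ≡τπ) (sym (relabel-∘ v τ _)))
  fixed⇔ : ∀ v → (relabel (relabel v (π ⟨$⟩ʳ_)) σ ≡ relabel v (π ⟨$⟩ʳ_)) ⇔ (relabel v τ ≡ v)
  fixed⇔ v = mk⇔ (relabel-injective (π ⟨$⟩ʳ_) (π ⟨$⟩ˡ_) (λ _ → inverseʳ π) ∘ trans (sym (relabel-σ v)))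
                 (trans (relabel-σ v) ∘ cong (λ w → relabel w (π ⟨$⟩ʳ_)))

swapCopies : ∀ {F P : Set} → F ⊎ (P ⊎ P) → F ⊎ (P ⊎ P)
swapCopies = map₂ swap

swapCopies-involutive : ∀ {F P : Set} (y : F ⊎ (P ⊎ P)) → swapCopies (swapCopies y) ≡ y
swapCopies-involutive (inj₁ x)        = refl
swapCopies-involutive (inj₂ (inj₁ a)) = refl
swapCopies-involutive (inj₂ (inj₂ a)) = refl

blocks : ∀ f p → Fin (f + (p + p)) ↔ (Fin f ⊎ (Fin p ⊎ Fin p))
blocks f p = ↔-trans +↔⊎ (↔-refl ⊎-↔ +↔⊎)

swapBlocks : ∀ f p → Fin (f + (p + p)) → Fin (f + (p + p))
swapBlocks f p = from (blocks f p) ∘ swapCopies ∘ to (blocks f p)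

lookup-++-blocks : ∀ {f p} (c : Vec Bool f) (d₁ d₂ : Vec Bool p) y →
  lookup (c ++ (d₁ ++ d₂)) (from (blocks f p) y) ≡ [ lookup c , [ lookup d₁ , lookup d₂ ]′ ]′ y
lookup-++-blocks {f} {p} c d₁ d₂ (inj₁ x) =
  trans (lookup-splitAt f c _ _) (cong [ lookup c , lookup (d₁ ++ d₂) ]′ (splitAt-↑ˡ f x (p + p)))
lookup-++-blocks {f} {p} c d₁ d₂ (inj₂ y) =
  trans (lookup-splitAt f c _ _) (trans (cong [ lookup c , lookup (d₁ ++ d₂) ]′ (splitAt-↑ʳ f (p + p) _))
    (trans (lookup-splitAt p d₁ d₂ _) (cong [ lookup d₁ , lookup d₂ ]′ (splitAt-join p p y))))

relabel-swapBlocks : ∀ {f p} (c : Vec Bool f) (d₁ d₂ : Vec Bool p) →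
                     relabel (c ++ (d₁ ++ d₂)) (swapBlocks f p) ≡ c ++ (d₂ ++ d₁)
relabel-swapBlocks {f} {p} c d₁ d₂ = lookup-injective λ i → begin
  lookup (relabel (c ++ (d₁ ++ d₂)) (swapBlocks f p)) i             ≡⟨ lookup-relabel (c ++ (d₁ ++ d₂)) _ i ⟩
  lookup (c ++ (d₁ ++ d₂)) (from B (swapCopies (to B i)))           ≡⟨ lookup-++-blocks c d₁ d₂ (swapCopies (to B i)) ⟩
  [ lookup c , [ lookup d₁ , lookup d₂ ]′ ]′ (swapCopies (to B i))  ≡⟨ swapped (to B i) ⟩
  [ lookup c , [ lookup d₂ , lookup d₁ ]′ ]′ (to B i)               ≡⟨ lookup-++-blocks c d₂ d₁ (to B i) ⟨
  lookup (c ++ (d₂ ++ d₁)) (from B (to B i))                       ≡⟨ cong (lookup (c ++ (d₂ ++ d₁))) (strictlyInverseʳ B i) ⟩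
  lookup (c ++ (d₂ ++ d₁)) i                                       ∎
  where
  open ≡-Reasoning
  B : Fin (f + (p + p)) ↔ (Fin f ⊎ (Fin p ⊎ Fin p))
  B = blocks f p
  swapped : ∀ y → [ lookup c , [ lookup d₁ , lookup d₂ ]′ ]′ (swapCopies y) ≡ [ lookup c , [ lookup d₂ , lookup d₁ ]′ ]′ y
  swapped (inj₁ x)        = refl
  swapped (inj₂ (inj₁ a)) = refl
  swapped (inj₂ (inj₂ a)) = refl

swapBlocks-fixed⇔ : ∀ {f p} (c : Vec Bool f) (d₁ d₂ : Vec Bool p) →
                    (relabel (c ++ (d₁ ++ d₂)) (swapBlocks f p) ≡ c ++ (d₁ ++ d₂)) ⇔ (d₁ ≡ d₂)
swapBlocks-fixed⇔ c d₁ d₂ = mk⇔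
  (λ eq → sym (++-injectiveˡ d₂ d₁ (++-injectiveʳ c c (trans (sym (relabel-swapBlocks c d₁ d₂)) eq))))
  (λ { refl → relabel-swapBlocks c d₁ d₁ })

invariantColourings-swapBlocks : ∀ f p r →
  invariantColourings (f + (p + p)) (swapBlocks f p) r ≡ sumTo r (λ t → (f C t) * halfBinom p (r ∸ t))
invariantColourings-swapBlocks f p r = begin
  ∑ᵛ (f + (p + p)) G                                           ≡⟨ ∑ᵛ-++ f (p + p) G ⟩
  ∑ᵛ f (λ c → ∑ᵛ (p + p) (λ d → G (c ++ d)))                    ≡⟨ ∑ᵛ-cong f (λ c → ∑ᵛ-++ p p _) ⟩
  ∑ᵛ f (λ c → ∑ᵛ p (λ d₁ → ∑ᵛ p (λ d₂ → G (c ++ (d₁ ++ d₂)))))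
    ≡⟨ ∑ᵛ-cong f (λ c → ∑ᵛ-cong p (λ d₁ → trans (∑ᵛ-cong p (G-blocks c d₁)) (∑ᵛ-diagonal d₁ _))) ⟩
  ∑ᵛ f (λ c → ∑ᵛ p (λ d → 𝟙 (does (weight c + (weight d + weight d) ≟ r))))
    ≡⟨ ∑ᵛ-cong f (λ c → ∑ᵛ-offset-double p (weight c) r) ⟩
  ∑ᵛ f (λ c → guarded (weight c))                              ≡⟨ ∑ᵛ-weight f guarded ⟩
  sumTo f (λ t → (f C t) * guarded t)
    ≡⟨ sumTo-support f r (λ t f<t → cong (_* guarded t) (k>n⇒nCk≡0 f<t)) beyond-r ⟩
  sumTo r (λ t → (f C t) * guarded t)                          ≡⟨ sumTo-cong r (λ t t≤r → cong ((f C t) *_) (guarded-≤ t≤r)) ⟩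
  sumTo r (λ t → (f C t) * halfBinom p (r ∸ t))                ∎
  where
  open ≡-Reasoning
  G : Vec Bool (f + (p + p)) → ℕ
  G v = 𝟙 (does (weight v ≟ r) ∧ does (relabel v (swapBlocks f p) ≟ᵛ v))
  G-blocks : ∀ c d₁ d₂ → G (c ++ (d₁ ++ d₂)) ≡ 𝟙 (does (d₁ ≟ᵛ d₂)) * 𝟙 (does (weight c + (weight d₁ + weight d₂) ≟ r))
  G-blocks c d₁ d₂ = trans (cong₂ (λ a b → 𝟙 (a ∧ b))
      (cong (λ w → does (w ≟ r)) (trans (weight-++ c (d₁ ++ d₂)) (cong (weight c +_) (weight-++ d₁ d₂))))
      (does-⇔ (swapBlocks-fixed⇔ c d₁ d₂) (_ ≟ᵛ _) (d₁ ≟ᵛ d₂)))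
    (trans (𝟙-∧ (does (weight c + (weight d₁ + weight d₂) ≟ r)) _) (*-comm _ (𝟙 (does (d₁ ≟ᵛ d₂)))))
  -- r ∸ t truncates, so the terms with t > r have to be cut off explicitly.
  guarded : ℕ → ℕ
  guarded t = 𝟙 (does (t ≤? r)) * halfBinom p (r ∸ t)
  guarded-≤ : ∀ {t} → t ≤ r → guarded t ≡ halfBinom p (r ∸ t)
  guarded-≤ {t} t≤r = trans (cong (λ b → 𝟙 b * halfBinom p (r ∸ t)) (dec-true (t ≤? r) t≤r)) (*-identityˡ _)
  beyond-r : ∀ t → r < t → (f C t) * guarded t ≡ 0
  beyond-r t r<t = trans (cong (λ b → (f C t) * (𝟙 b * halfBinom p (r ∸ t))) (dec-false (t ≤? r) (<⇒≱ r<t))) (*-zeroʳ (f C t))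

record CycleDecomposition {A : Set} (σ : A → A) (F P : Set) : Set where
  field
    decompose   : A ↔ (F ⊎ (P ⊎ P))
    decompose-σ : ∀ x → to decompose (σ x) ≡ swapCopies (to decompose x)

open CycleDecomposition

invariantColourings-cycles : ∀ {n f p} {σ : Fin n → Fin n} → CycleDecomposition σ (Fin f) (Fin p) →
  ∀ r → invariantColourings n σ r ≡ sumTo r (λ t → (f C t) * halfBinom p (r ∸ t))
invariantColourings-cycles {n} {f} {p} {σ} D r =
  trans (invariantColourings-conj π σ (swapBlocks f p) πσ≡swapπ r) (invariantColourings-swapBlocks f p r)
  where
  π : Permutation n (f + (p + p))
  π = ↔-trans (decompose D) (↔-sym (blocks f p))
  πσ≡swapπ : ∀ x → π ⟨$⟩ʳ σ x ≡ swapBlocks f p (π ⟨$⟩ʳ x)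
  πσ≡swapπ x = cong (from (blocks f p))
    (trans (decompose-σ D x) (cong swapCopies (sym (strictlyInverseˡ (blocks f p) (to (decompose D) x)))))

id-cycles : ∀ {A : Set} → CycleDecomposition (λ (x : A) → x) A (Fin 0)
id-cycles {A} = record { decompose = mk↔ₛ′ inj₁ fixedPart section (λ _ → refl) ; decompose-σ = λ _ → refl }
  where
  fixedPart : A ⊎ (Fin 0 ⊎ Fin 0) → A
  fixedPart (inj₁ x) = x
  fixedPart (inj₂ (inj₁ ()))
  fixedPart (inj₂ (inj₂ ()))
  section : ∀ y → inj₁ (fixedPart y) ≡ y
  section (inj₁ x) = refl
  section (inj₂ (inj₁ ()))
  section (inj₂ (inj₂ ()))

pullback-cycles : ∀ {A B F P : Set} {σ : A → A} {τ : B → B} (e : B ↔ A) →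
  (∀ y → to e (τ y) ≡ σ (to e y)) → CycleDecomposition σ F P → CycleDecomposition τ F P
pullback-cycles e eτ≡σe D = record
  { decompose   = ↔-trans e (decompose D)
  ; decompose-σ = λ y → trans (cong (to (decompose D)) (eτ≡σe y)) (decompose-σ D (to e y)) }

reindex-cycles : ∀ {A F F′ P P′ : Set} {σ : A → A} → F ↔ F′ → P ↔ P′ →
  CycleDecomposition σ F P → CycleDecomposition σ F′ P′
reindex-cycles {F = F} {F′} {P} {P′} eF eP D = record
  { decompose   = ↔-trans (decompose D) (eF ⊎-↔ (eP ⊎-↔ eP))
  ; decompose-σ = λ x → trans (cong reindex (decompose-σ D x)) (natural (to (decompose D) x)) }
  where
  reindex : F ⊎ (P ⊎ P) → F′ ⊎ (P′ ⊎ P′)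
  reindex = to (eF ⊎-↔ (eP ⊎-↔ eP))
  natural : ∀ y → reindex (swapCopies y) ≡ swapCopies (reindex y)
  natural (inj₁ x)        = refl
  natural (inj₂ (inj₁ a)) = refl
  natural (inj₂ (inj₂ a)) = refl

-- A transposition of σ × τ either moves only the second coordinate, or it moves the first,
-- and then exactly one of its two points has its first coordinate in the first copy of P.
ProductTranspositions : (F P F′ P′ : Set) → Set
ProductTranspositions F P F′ P′ = (F × P′) ⊎ (P × (F′ ⊎ (P′ ⊎ P′)))

module _ {F P F′ P′ : Set} where

  private
    Q : Set
    Q = ProductTranspositions F P F′ P′

    pairCycles : (F ⊎ (P ⊎ P)) × (F′ ⊎ (P′ ⊎ P′)) → (F × F′) ⊎ (Q ⊎ Q)
    pairCycles (inj₁ x , inj₁ y)        = inj₁ (x , y)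
    pairCycles (inj₁ x , inj₂ (inj₁ b)) = inj₂ (inj₁ (inj₁ (x , b)))
    pairCycles (inj₁ x , inj₂ (inj₂ b)) = inj₂ (inj₂ (inj₁ (x , b)))
    pairCycles (inj₂ (inj₁ a) , z)      = inj₂ (inj₁ (inj₂ (a , z)))
    pairCycles (inj₂ (inj₂ a) , z)      = inj₂ (inj₂ (inj₂ (a , swapCopies z)))

    unpairCycles : (F × F′) ⊎ (Q ⊎ Q) → (F ⊎ (P ⊎ P)) × (F′ ⊎ (P′ ⊎ P′))
    unpairCycles (inj₁ (x , y))               = inj₁ x , inj₁ y
    unpairCycles (inj₂ (inj₁ (inj₁ (x , b)))) = inj₁ x , inj₂ (inj₁ b)
    unpairCycles (inj₂ (inj₂ (inj₁ (x , b)))) = inj₁ x , inj₂ (inj₂ b)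
    unpairCycles (inj₂ (inj₁ (inj₂ (a , z)))) = inj₂ (inj₁ a) , z
    unpairCycles (inj₂ (inj₂ (inj₂ (a , z)))) = inj₂ (inj₂ a) , swapCopies z

    pair-unpair : ∀ q → pairCycles (unpairCycles q) ≡ q
    pair-unpair (inj₁ (x , y))               = refl
    pair-unpair (inj₂ (inj₁ (inj₁ (x , b)))) = refl
    pair-unpair (inj₂ (inj₂ (inj₁ (x , b)))) = refl
    pair-unpair (inj₂ (inj₁ (inj₂ (a , z)))) = refl
    pair-unpair (inj₂ (inj₂ (inj₂ (a , z)))) = cong (λ w → inj₂ (inj₂ (inj₂ (a , w)))) (swapCopies-involutive z)

    unpair-pair : ∀ u → unpairCycles (pairCycles u) ≡ u
    unpair-pair (inj₁ x , inj₁ y)        = refl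
    unpair-pair (inj₁ x , inj₂ (inj₁ b)) = refl
    unpair-pair (inj₁ x , inj₂ (inj₂ b)) = refl
    unpair-pair (inj₂ (inj₁ a) , z)      = refl
    unpair-pair (inj₂ (inj₂ a) , z)      = cong (inj₂ (inj₂ a) ,_) (swapCopies-involutive z)

    pair-swapCopies : ∀ u v → pairCycles (swapCopies u , swapCopies v) ≡ swapCopies (pairCycles (u , v))
    pair-swapCopies (inj₁ x)        (inj₁ y)        = refl
    pair-swapCopies (inj₁ x)        (inj₂ (inj₁ b)) = refl
    pair-swapCopies (inj₁ x)        (inj₂ (inj₂ b)) = refl
    pair-swapCopies (inj₂ (inj₁ a)) z               = cong (λ w → inj₂ (inj₂ (inj₂ (a , w)))) (swapCopies-involutive z)
    pair-swapCopies (inj₂ (inj₂ a)) z               = refl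

  ×-cycles : ∀ {A B : Set} {σ : A → A} {τ : B → B} →
    CycleDecomposition σ F P → CycleDecomposition τ F′ P′ → CycleDecomposition (map σ τ) (F × F′) Q
  ×-cycles D D′ = record
    { decompose   = ↔-trans (decompose D ×-↔ decompose D′) (mk↔ₛ′ pairCycles unpairCycles pair-unpair unpair-pair)
    ; decompose-σ = λ (x , y) → trans (cong₂ (λ u v → pairCycles (u , v)) (decompose-σ D x) (decompose-σ D′ y))
                                      (pair-swapCopies (to (decompose D) x) (to (decompose D′) y)) }

_⊗_ : ∀ {m n} → (Fin m → Fin m) → (Fin n → Fin n) → Fin (m * n) → Fin (m * n)
(σ ⊗ τ) x = uncurry combine (map σ τ (remQuot _ x))

⊗-cycles : ∀ {m n c h c′ h′} {σ : Fin m → Fin m} {τ : Fin n → Fin n} →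
  CycleDecomposition σ (Fin c) (Fin h) → CycleDecomposition τ (Fin c′) (Fin h′) →
  CycleDecomposition (σ ⊗ τ) (Fin (c * c′)) (Fin (c * h′ + h * (c′ + (h′ + h′))))
⊗-cycles {m} {n} {σ = σ} {τ} D D′ =
  pullback-cycles *↔× (λ x → uncurry remQuot-combine (map σ τ (remQuot n x)))
    (reindex-cycles (Fin-× ↔-refl ↔-refl) (Fin-⊎ (Fin-× ↔-refl ↔-refl) (Fin-× ↔-refl (Fin-⊎ ↔-refl (Fin-⊎ ↔-refl ↔-refl))))
      (×-cycles D D′))
  where
  Fin-× : ∀ {A B : Set} {a b} → A ↔ Fin a → B ↔ Fin b → (A × B) ↔ Fin (a * b)
  Fin-× eA eB = ↔-trans (eA ×-↔ eB) (↔-sym *↔×)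
  Fin-⊎ : ∀ {A B : Set} {a b} → A ↔ Fin a → B ↔ Fin b → (A ⊎ B) ↔ Fin (a + b)
  Fin-⊎ eA eB = ↔-trans (eA ⊎-↔ eB) (↔-sym +↔⊎)

opposite-outer : ∀ {h c} (a : Fin h) → opposite ((a ↑ˡ c) ↑ˡ h) ≡ (h + c) ↑ʳ opposite a
opposite-outer {h} {c} a = toℕ-injective (begin
  toℕ (opposite ((a ↑ˡ c) ↑ˡ h))         ≡⟨ opposite-prop ((a ↑ˡ c) ↑ˡ h) ⟩
  h + c + h ∸ suc (toℕ ((a ↑ˡ c) ↑ˡ h))  ≡⟨ cong (λ i → h + c + h ∸ suc i) (trans (toℕ-↑ˡ (a ↑ˡ c) h) (toℕ-↑ˡ a c)) ⟩
  h + c + h ∸ suc (toℕ a)                ≡⟨ +-∸-assoc (h + c) (toℕ<n a) ⟩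
  h + c + (h ∸ suc (toℕ a))              ≡⟨ cong (h + c +_) (opposite-prop a) ⟨
  h + c + toℕ (opposite a)               ≡⟨ toℕ-↑ʳ (h + c) (opposite a) ⟨
  toℕ ((h + c) ↑ʳ opposite a)            ∎)
  where open ≡-Reasoning

opposite-middle : ∀ {h c} (i : Fin c) → opposite ((h ↑ʳ i) ↑ˡ h) ≡ (h ↑ʳ opposite i) ↑ˡ h
opposite-middle {h} {c} i = toℕ-injective (begin
  toℕ (opposite ((h ↑ʳ i) ↑ˡ h))         ≡⟨ opposite-prop ((h ↑ʳ i) ↑ˡ h) ⟩
  h + c + h ∸ suc (toℕ ((h ↑ʳ i) ↑ˡ h))  ≡⟨ cong (λ j → h + c + h ∸ suc j) (trans (toℕ-↑ˡ (h ↑ʳ i) h) (toℕ-↑ʳ h i)) ⟩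
  h + c + h ∸ suc (h + toℕ i)            ≡⟨ cong₂ _∸_ (+-assoc h c h) (sym (+-suc h (toℕ i))) ⟩
  h + (c + h) ∸ (h + suc (toℕ i))        ≡⟨ [m+n]∸[m+o]≡n∸o h (c + h) (suc (toℕ i)) ⟩
  c + h ∸ suc (toℕ i)                    ≡⟨ +-∸-comm h (toℕ<n i) ⟩
  c ∸ suc (toℕ i) + h                    ≡⟨ +-comm _ h ⟩
  h + (c ∸ suc (toℕ i))                  ≡⟨ cong (h +_) (opposite-prop i) ⟨
  h + toℕ (opposite i)                   ≡⟨ toℕ-↑ʳ h (opposite i) ⟨
  toℕ (h ↑ʳ opposite i)                  ≡⟨ toℕ-↑ˡ (h ↑ʳ opposite i) h ⟨
  toℕ ((h ↑ʳ opposite i) ↑ˡ h)           ∎)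
  where open ≡-Reasoning

opposite-cycles : ∀ {n} h c → n ≡ h + c + h → (∀ (i : Fin c) → opposite i ≡ i) →
                  CycleDecomposition (opposite {n}) (Fin c) (Fin h)
opposite-cycles h c refl opposite-fixes = record
  { decompose   = mk↔ₛ′ unfold fold unfold-fold fold-unfold
  ; decompose-σ = λ x → begin
      unfold (opposite x)                    ≡⟨ cong (unfold ∘ opposite) (fold-unfold x) ⟨
      unfold (opposite (fold (unfold x)))    ≡⟨ cong unfold (fold-swapCopies (unfold x)) ⟨
      unfold (fold (swapCopies (unfold x)))  ≡⟨ unfold-fold _ ⟩
      swapCopies (unfold x)                  ∎ }
  where
  open ≡-Reasoning
  fold : Fin c ⊎ (Fin h ⊎ Fin h) → Fin (h + c + h)
  fold (inj₁ i)        = (h ↑ʳ i) ↑ˡ h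
  fold (inj₂ (inj₁ a)) = (a ↑ˡ c) ↑ˡ h
  fold (inj₂ (inj₂ a)) = (h + c) ↑ʳ opposite a

  unfoldLeft : Fin h ⊎ Fin c → Fin c ⊎ (Fin h ⊎ Fin h)
  unfoldLeft = [ inj₂ ∘ inj₁ , inj₁ ]′

  unfold′ : Fin (h + c) ⊎ Fin h → Fin c ⊎ (Fin h ⊎ Fin h)
  unfold′ = [ unfoldLeft ∘ splitAt h , inj₂ ∘ inj₂ ∘ opposite ]′

  unfold : Fin (h + c + h) → Fin c ⊎ (Fin h ⊎ Fin h)
  unfold = unfold′ ∘ splitAt (h + c)

  unfold-fold : ∀ y → unfold (fold y) ≡ y
  unfold-fold (inj₁ i)        = trans (cong unfold′ (splitAt-↑ˡ (h + c) (h ↑ʳ i) h)) (cong unfoldLeft (splitAt-↑ʳ h c i))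
  unfold-fold (inj₂ (inj₁ a)) = trans (cong unfold′ (splitAt-↑ˡ (h + c) (a ↑ˡ c) h)) (cong unfoldLeft (splitAt-↑ˡ h a c))
  unfold-fold (inj₂ (inj₂ a)) = trans (cong unfold′ (splitAt-↑ʳ (h + c) h (opposite a))) (cong (inj₂ ∘ inj₂) (opposite-involutive a))

  fold-unfoldLeft : ∀ s → fold (unfoldLeft s) ≡ join h c s ↑ˡ h
  fold-unfoldLeft (inj₁ a) = refl
  fold-unfoldLeft (inj₂ i) = refl

  fold-unfold′ : ∀ s → fold (unfold′ s) ≡ join (h + c) h s
  fold-unfold′ (inj₁ y) = trans (fold-unfoldLeft (splitAt h y)) (cong (_↑ˡ h) (join-splitAt h c y))
  fold-unfold′ (inj₂ b) = cong ((h + c) ↑ʳ_) (opposite-involutive b)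

  fold-unfold : ∀ x → fold (unfold x) ≡ x
  fold-unfold x = trans (fold-unfold′ (splitAt (h + c) x)) (join-splitAt (h + c) h x)

  fold-swapCopies : ∀ y → fold (swapCopies y) ≡ opposite (fold y)
  fold-swapCopies (inj₁ i)        = sym (trans (opposite-middle i) (cong (λ j → (h ↑ʳ j) ↑ˡ h) (opposite-fixes i)))
  fold-swapCopies (inj₂ (inj₁ a)) = sym (opposite-outer a)
  fold-swapCopies (inj₂ (inj₂ a)) = begin
    (a ↑ˡ c) ↑ˡ h                        ≡⟨ opposite-involutive _ ⟨
    opposite (opposite ((a ↑ˡ c) ↑ˡ h))  ≡⟨ cong opposite (opposite-outer a) ⟩
    opposite ((h + c) ↑ʳ opposite a)     ∎

-- Burnside's lemma for the Klein four-group

Klein : Set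
Klein = Bool × Bool

ε : Klein
ε = false , false

infixl 7 _·_
_·_ : Klein → Klein → Klein
(a , b) · (a′ , b′) = a xor a′ , b xor b′

·-self : ∀ g → g · g ≡ ε
·-self (a , b) = cong₂ _,_ (xor-same a) (xor-same b)

elements : List Klein
elements = (false , false) ∷ (false , true) ∷ (true , false) ∷ (true , true) ∷ []

∈-elements : ∀ g → g ∈ elements
∈-elements (false , false) = here refl
∈-elements (false , true)  = there (here refl)
∈-elements (true , false)  = there (there (here refl))
∈-elements (true , true)   = there (there (there (here refl)))

∑Bool : (Bool → ℕ) → ℕ
∑Bool f = f false + f true

∑Klein : (Klein → ℕ) → ℕ
∑Klein f = ∑Bool (λ a → ∑Bool (λ b → f (a , b)))

∑Bool-cong : ∀ {f g : Bool → ℕ} → (∀ a → f a ≡ g a) → ∑Bool f ≡ ∑Bool g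
∑Bool-cong f≗g = cong₂ _+_ (f≗g false) (f≗g true)

∑Klein-cong : ∀ {f g : Klein → ℕ} → (∀ h → f h ≡ g h) → ∑Klein f ≡ ∑Klein g
∑Klein-cong f≗g = ∑Bool-cong (λ a → ∑Bool-cong (λ b → f≗g (a , b)))

∑Bool-xor : ∀ a (f : Bool → ℕ) → ∑Bool (f ∘ (a xor_)) ≡ ∑Bool f
∑Bool-xor false f = refl
∑Bool-xor true  f = +-comm (f true) (f false)

∑Klein-translate : ∀ g (f : Klein → ℕ) → ∑Klein (λ h → f (g · h)) ≡ ∑Klein f
∑Klein-translate (a , b) f = trans (∑Bool-cong (λ a′ → ∑Bool-xor b (λ b′ → f (a xor a′ , b′))))
                                   (∑Bool-xor a (λ a′ → ∑Bool (λ b′ → f (a′ , b′))))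

∑Klein-const : ∀ n → ∑Klein (λ _ → n) ≡ 4 * n
∑Klein-const = solve 1 (λ n → (n :+ n) :+ (n :+ n) := con 4 :* n) refl

∑Klein-sumFin : ∀ M (F : Klein → Fin M → ℕ) → ∑Klein (λ g → sumFin M (F g)) ≡ sumFin M (λ x → ∑Klein (λ g → F g x))
∑Klein-sumFin M F = trans (∑Bool-cong (λ a → ∑Bool-sumFin (λ b → F (a , b)))) (∑Bool-sumFin (λ a x → ∑Bool (λ b → F (a , b) x)))
  where
  ∑Bool-sumFin : (H : Bool → Fin M → ℕ) → ∑Bool (λ a → sumFin M (H a)) ≡ sumFin M (λ x → ∑Bool (λ a → H a x))
  ∑Bool-sumFin H = sym (sumFin-distrib-+ M (H false) (H true))

count : ∀ {M} → (Fin M → Bool) → ℕ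
count {M} q = sumFin M (𝟙 ∘ q)

module Burnside {M : ℕ} (_⊙_ : Klein → Fin M → Fin M)
                (⊙-ε : ∀ x → ε ⊙ x ≡ x) (⊙-· : ∀ g h x → g ⊙ (h ⊙ x) ≡ (g · h) ⊙ x) where

  ⊙-involutive : ∀ g x → g ⊙ (g ⊙ x) ≡ x
  ⊙-involutive g x = trans (⊙-· g g x) (trans (cong (_⊙ x) (·-self g)) (⊙-ε x))

  -- Opaque because unfolding argmin while checking the lemmas below is prohibitively slow.
  opaque
    minimiser : Fin M → Klein
    minimiser x = Extrema.argmin (λ g → toℕ (g ⊙ x)) ε elements

    minimiser-≤ : ∀ g x → toℕ (minimiser x ⊙ x) ≤ toℕ (g ⊙ x)
    minimiser-≤ g x = All.lookup (Extrema.f[argmin]≤f[xs] {f = λ h → toℕ (h ⊙ x)} ε elements) (∈-elements g)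

  canon : Fin M → Fin M
  canon x = minimiser x ⊙ x

  canon-⊙ : ∀ g x → canon (g ⊙ x) ≡ canon x
  canon-⊙ g x = toℕ-injective (≤-antisym (begin
    toℕ (canon (g ⊙ x))                ≤⟨ minimiser-≤ (minimiser x · g) (g ⊙ x) ⟩
    toℕ ((minimiser x · g) ⊙ (g ⊙ x))  ≡⟨ cong toℕ (⊙-· (minimiser x) g (g ⊙ x)) ⟨
    toℕ (minimiser x ⊙ (g ⊙ (g ⊙ x)))  ≡⟨ cong (λ y → toℕ (minimiser x ⊙ y)) (⊙-involutive g x) ⟩
    toℕ (canon x)                      ∎) (begin
    toℕ (canon x)                      ≤⟨ minimiser-≤ (minimiser (g ⊙ x) · g) x ⟩
    toℕ ((minimiser (g ⊙ x) · g) ⊙ x)  ≡⟨ cong toℕ (⊙-· (minimiser (g ⊙ x)) g x) ⟨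
    toℕ (canon (g ⊙ x))                ∎))
    where open ≤-Reasoning

  canon-idempotent : ∀ x → canon (canon x) ≡ canon x
  canon-idempotent x = canon-⊙ (minimiser x) x

  canon-orbit : ∀ x y → canon x ≡ canon y → Σ Klein (λ g → y ≡ g ⊙ x)
  canon-orbit x y eq = minimiser y · minimiser x , (begin
    y                                ≡⟨ ⊙-involutive (minimiser y) y ⟨
    minimiser y ⊙ canon y            ≡⟨ cong (minimiser y ⊙_) eq ⟨
    minimiser y ⊙ (minimiser x ⊙ x)  ≡⟨ ⊙-· (minimiser y) (minimiser x) x ⟩
    (minimiser y · minimiser x) ⊙ x  ∎)
    where open ≡-Reasoning

  isCanonical : Fin M → Bool
  isCanonical x = does (canon x ≟ᶠ x)

  ∑Klein-isCanonical : ∀ x → ∑Klein (λ g → 𝟙 (isCanonical (g ⊙ x))) ≡ ∑Klein (λ g → 𝟙 (does (g ⊙ x ≟ᶠ x)))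
  ∑Klein-isCanonical x = begin
    ∑Klein (λ g → 𝟙 (isCanonical (g ⊙ x)))
      ≡⟨ ∑Klein-cong (λ g → cong 𝟙 (does-⇔ (canonical⇔fixed g) (canon (g ⊙ x) ≟ᶠ g ⊙ x) ((m · g) ⊙ x ≟ᶠ x))) ⟩
    ∑Klein (λ g → 𝟙 (does ((m · g) ⊙ x ≟ᶠ x)))  ≡⟨ ∑Klein-translate m (λ g → 𝟙 (does (g ⊙ x ≟ᶠ x))) ⟩
    ∑Klein (λ g → 𝟙 (does (g ⊙ x ≟ᶠ x)))        ∎
    where
    open ≡-Reasoning
    m : Klein
    m = minimiser x
    canonical⇔fixed : ∀ g → (canon (g ⊙ x) ≡ g ⊙ x) ⇔ ((m · g) ⊙ x ≡ x)
    canonical⇔fixed g = mk⇔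
      (λ eq → begin
        (m · g) ⊙ x        ≡⟨ ⊙-· m g x ⟨
        m ⊙ (g ⊙ x)        ≡⟨ cong (m ⊙_) (trans (sym eq) (canon-⊙ g x)) ⟩
        m ⊙ (m ⊙ x)        ≡⟨ ⊙-involutive m x ⟩
        x                  ∎)
      (λ eq → begin
        canon (g ⊙ x)      ≡⟨ canon-⊙ g x ⟩
        m ⊙ x              ≡⟨ cong (m ⊙_) eq ⟨
        m ⊙ ((m · g) ⊙ x)  ≡⟨ cong (m ⊙_) (⊙-· m g x) ⟨
        m ⊙ (m ⊙ (g ⊙ x))  ≡⟨ ⊙-involutive m (g ⊙ x) ⟩
        g ⊙ x              ∎)

  burnside : ∀ (P : Fin M → Bool) → (∀ g x → P (g ⊙ x) ≡ P x) →
             4 * count (λ x → P x ∧ isCanonical x) ≡ ∑Klein (λ g → count (λ x → P x ∧ does (g ⊙ x ≟ᶠ x)))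
  burnside P P-⊙ = sym (begin
    ∑Klein (λ g → sumFin M (λ x → 𝟙 (fixed g x)))   ≡⟨ ∑Klein-sumFin M (λ g x → 𝟙 (fixed g x)) ⟩
    sumFin M (λ x → ∑Klein (λ g → 𝟙 (fixed g x)))   ≡⟨ sumFin-cong M restrict ⟨
    sumFin M (λ x → ∑Klein (λ g → 𝟙 (P x ∧ isCanonical (g ⊙ x))))
      ≡⟨ sumFin-cong M (λ x → ∑Klein-cong (λ g → cong (λ b → 𝟙 (b ∧ isCanonical (g ⊙ x))) (P-⊙ g x))) ⟨
    sumFin M (λ x → ∑Klein (λ g → 𝟙 (q (g ⊙ x))))   ≡⟨ ∑Klein-sumFin M (λ g x → 𝟙 (q (g ⊙ x))) ⟨
    ∑Klein (λ g → sumFin M (λ x → 𝟙 (q (g ⊙ x))))   ≡⟨ ∑Klein-cong (λ g → sumFin-permute (⊙-permutation g) (𝟙 ∘ q)) ⟨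
    ∑Klein (λ _ → count q)                          ≡⟨ ∑Klein-const (count q) ⟩
    4 * count q                                     ∎)
    where
    open ≡-Reasoning
    q : Fin M → Bool
    q x = P x ∧ isCanonical x
    fixed : Klein → Fin M → Bool
    fixed g x = P x ∧ does (g ⊙ x ≟ᶠ x)
    ⊙-permutation : Klein → Permutation M M
    ⊙-permutation g = permutation (g ⊙_) (g ⊙_) (⊙-involutive g) (⊙-involutive g)
    restrict : ∀ x → ∑Klein (λ g → 𝟙 (P x ∧ isCanonical (g ⊙ x))) ≡ ∑Klein (λ g → 𝟙 (fixed g x))
    restrict x with P x
    ... | false = refl
    ... | true  = ∑Klein-isCanonical x

-- Counting classes by a complete invariant

rank : ∀ {M} → (Fin M → Bool) → Fin M → ℕ
rank q Fin.zero    = 0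
rank q (Fin.suc j) = 𝟙 (q Fin.zero) + rank (q ∘ Fin.suc) j

rank<count : ∀ {M} (q : Fin M → Bool) j → T (q j) → rank q j < count q
rank<count q Fin.zero    qj with q Fin.zero
... | true = s≤s z≤n
rank<count q (Fin.suc j) qj = +-monoʳ-< (𝟙 (q Fin.zero)) (rank<count (q ∘ Fin.suc) j qj)

rank-injective : ∀ {M} (q : Fin M → Bool) i j → T (q i) → T (q j) → rank q i ≡ rank q j → i ≡ j
rank-injective q Fin.zero    Fin.zero    _  _  _  = refl
rank-injective q Fin.zero    (Fin.suc j) qi _  eq with q Fin.zero
rank-injective q Fin.zero    (Fin.suc j) qi _  () | true
rank-injective q (Fin.suc i) Fin.zero    _  qj eq with q Fin.zero
rank-injective q (Fin.suc i) Fin.zero    _  qj () | true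
rank-injective q (Fin.suc i) (Fin.suc j) qi qj eq =
  cong Fin.suc (rank-injective (q ∘ Fin.suc) i j qi qj (+-cancelˡ-≡ (𝟙 (q Fin.zero)) _ _ eq))

rank-surjective : ∀ {M} (q : Fin M → Bool) c → c < count q → Σ (Fin M) (λ j → T (q j) × rank q j ≡ c)
rank-surjective {suc M} q c c<count with q Fin.zero in q0
rank-surjective {suc M} q zero    _       | true = Fin.zero , subst T (sym q0) tt , refl
rank-surjective {suc M} q (suc c) c<count | true with rank-surjective (q ∘ Fin.suc) c (s≤s⁻¹ c<count)
... | j , qj , rank≡c = Fin.suc j , qj , trans (cong (λ b → 𝟙 b + rank (q ∘ Fin.suc) j) q0) (cong suc rank≡c)
rank-surjective {suc M} q c c<count | false with rank-surjective (q ∘ Fin.suc) c c<count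
... | j , qj , rank≡c = Fin.suc j , qj , trans (cong (λ b → 𝟙 b + rank (q ∘ Fin.suc) j) q0) rank≡c

hasNumClasses-byInvariant : ∀ {A : Set} {M} (_≈_ : A → A → Set) (q : Fin M → Bool) (κ : A → Fin M) →
  (∀ x → T (q (κ x))) → (∀ x y → κ x ≡ κ y → x ≈ y) → (∀ x y → x ≈ y → κ x ≡ κ y) →
  (∀ j → T (q j) → Σ A (λ x → κ x ≡ j)) → HasNumClasses _≈_ (count q)
hasNumClasses-byInvariant {A} _≈_ q κ qκ κ-sound κ-complete κ-onto =
  classOf , (λ x y → sound x y , complete x y) , onto
  where
  classOf : A → Fin (count q)
  classOf x = fromℕ< (rank<count q (κ x) (qκ x))
  toℕ-classOf : ∀ x → toℕ (classOf x) ≡ rank q (κ x)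
  toℕ-classOf x = toℕ-fromℕ< (rank<count q (κ x) (qκ x))
  sound : ∀ x y → classOf x ≡ classOf y → x ≈ y
  sound x y eq = κ-sound x y (rank-injective q (κ x) (κ y) (qκ x) (qκ y)
    (trans (sym (toℕ-classOf x)) (trans (cong toℕ eq) (toℕ-classOf y))))
  complete : ∀ x y → x ≈ y → classOf x ≡ classOf y
  complete x y x≈y = toℕ-injective (trans (toℕ-classOf x) (trans (cong (rank q) (κ-complete x y x≈y)) (sym (toℕ-classOf y))))
  onto : ∀ c → Σ A (λ x → classOf x ≡ c)
  onto c with rank-surjective q (toℕ c) (toℕ<n c)
  ... | j , qj , rank≡c with κ-onto j qj
  ...   | x , κx≡j = x , toℕ-injective (trans (toℕ-classOf x) (trans (cong (rank q) κx≡j) rank≡c))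

-- Boards

flipIf : ∀ {n} → Bool → Fin n → Fin n
flipIf false i = i
flipIf true  i = opposite i

flipIf-xor : ∀ {n} a b (i : Fin n) → flipIf b (flipIf a i) ≡ flipIf (a xor b) i
flipIf-xor false b     i = refl
flipIf-xor true  false i = refl
flipIf-xor true  true  i = opposite-involutive i

module Grids (m n : ℕ) where

  -- (a , b) reflects the rows iff a and the columns iff b: (true , false), (false , true)
  -- and (true , true) act as H, V and R180.
  gridAct : Klein → Grid m n → Grid m n
  gridAct (a , b) B i j = B (flipIf a i) (flipIf b j)

  ∼⇒gridAct : ∀ {r} {b c : Board m n r} → b ∼ c → Σ Klein (λ g → proj₁ c ≐ gridAct g (proj₁ b))
  ∼⇒gridAct (inj₁ c≐)               = (false , false) , c≐
  ∼⇒gridAct (inj₂ (inj₁ c≐))        = (true , false) , c≐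
  ∼⇒gridAct (inj₂ (inj₂ (inj₁ c≐))) = (false , true) , c≐
  ∼⇒gridAct (inj₂ (inj₂ (inj₂ c≐))) = (true , true) , c≐

  gridAct⇒∼ : ∀ {r} {b c : Board m n r} g → proj₁ c ≐ gridAct g (proj₁ b) → b ∼ c
  gridAct⇒∼ (false , false) c≐ = inj₁ c≐
  gridAct⇒∼ (true , false)  c≐ = inj₂ (inj₁ c≐)
  gridAct⇒∼ (false , true)  c≐ = inj₂ (inj₂ (inj₁ c≐))
  gridAct⇒∼ (true , true)   c≐ = inj₂ (inj₂ (inj₂ c≐))

  cellAct : Klein → Fin (m * n) → Fin (m * n)
  cellAct (a , b) = flipIf {m} a ⊗ flipIf {n} b

  cellAct-ε : ∀ x → cellAct ε x ≡ x
  cellAct-ε = combine-remQuot {m} n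

  cellAct-· : ∀ g h x → cellAct h (cellAct g x) ≡ cellAct (g · h) x
  cellAct-· (a , b) (a′ , b′) x = flip-twice (remQuot {m} n x)
    where
    flip-twice : ∀ p → cellAct (a′ , b′) (uncurry combine (map (flipIf a) (flipIf b) p))
                       ≡ uncurry combine (map (flipIf (a xor a′)) (flipIf (b xor b′)) p)
    flip-twice (i , j) = trans (cong (uncurry combine ∘ map (flipIf a′) (flipIf b′)) (remQuot-combine (flipIf a i) (flipIf b j)))
                               (cong₂ combine (flipIf-xor a a′ i) (flipIf-xor b b′ j))

  cellAct-involutive : ∀ g x → cellAct g (cellAct g x) ≡ x
  cellAct-involutive g x = trans (cellAct-· g g x) (trans (cong (λ h → cellAct h x) (·-self g)) (cellAct-ε x))

  cellPermutation : Klein → Permutation (m * n) (m * n)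
  cellPermutation g = permutation (cellAct g) (cellAct g) (cellAct-involutive g) (cellAct-involutive g)

  toVec : Grid m n → Vec Bool (m * n)
  toVec B = tabulate (uncurry B ∘ remQuot {m} n)

  toGrid : Vec Bool (m * n) → Grid m n
  toGrid v i j = lookup v (combine i j)

  toGrid-toVec : ∀ B → toGrid (toVec B) ≐ B
  toGrid-toVec B i j = trans (lookup∘tabulate _ (combine i j)) (cong (uncurry B) (remQuot-combine i j))

  toVec-toGrid : ∀ v → toVec (toGrid v) ≡ v
  toVec-toGrid v = trans (tabulate-cong (cong (lookup v) ∘ combine-remQuot {m} n)) (tabulate∘lookup v)

  toVec-cong : ∀ {B B′} → B ≐ B′ → toVec B ≡ toVec B′
  toVec-cong B≐B′ = tabulate-cong (λ x → B≐B′ (proj₁ (remQuot {m} n x)) (proj₂ (remQuot {m} n x)))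

  toVec-injective : ∀ {B B′} → toVec B ≡ toVec B′ → B ≐ B′
  toVec-injective {B} {B′} eq i j = trans (sym (toGrid-toVec B i j)) (trans (cong (λ v → toGrid v i j) eq) (toGrid-toVec B′ i j))

  toVec-gridAct : ∀ g B → toVec (gridAct g B) ≡ relabel (toVec B) (cellAct g)
  toVec-gridAct (a , b) B = tabulate-cong λ x → sym (trans (lookup∘tabulate _ (cellAct (a , b) x))
    (cong (uncurry B) (uncurry remQuot-combine (map (flipIf a) (flipIf b) (remQuot {m} n x)))))

  blockedCount-toGrid : ∀ v → blockedCount (toGrid v) ≡ weight v
  blockedCount-toGrid v = sym (sumFin-combine m n (𝟙 ∘ lookup v))

  weight-toVec : ∀ B → weight (toVec B) ≡ blockedCount B
  weight-toVec B = trans (sym (blockedCount-toGrid (toVec B))) (sumFin-cong m (λ i → sumFin-cong n (λ j → cong 𝟙 (toGrid-toVec B i j))))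

  module Boards (r : ℕ) where

    infixr 5 _⊙_
    _⊙_ : Klein → Fin (2 ^ (m * n)) → Fin (2 ^ (m * n))
    g ⊙ x = toCode (relabel (fromCode x) (cellAct g))

    ⊙-ε : ∀ x → ε ⊙ x ≡ x
    ⊙-ε x = trans (cong toCode (trans (relabel-cong (fromCode x) cellAct-ε) (relabel-id (fromCode x)))) (toCode-fromCode {m * n} x)

    ⊙-· : ∀ g h x → g ⊙ h ⊙ x ≡ (g · h) ⊙ x
    ⊙-· g h x = cong toCode (begin
      relabel (fromCode (toCode (relabel (fromCode x) (cellAct h)))) (cellAct g)
        ≡⟨ cong (λ v → relabel v (cellAct g)) (fromCode-toCode (relabel (fromCode x) (cellAct h))) ⟩
      relabel (relabel (fromCode x) (cellAct h)) (cellAct g)  ≡⟨ relabel-∘ (fromCode x) (cellAct h) (cellAct g) ⟩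
      relabel (fromCode x) (cellAct h ∘ cellAct g)           ≡⟨ relabel-cong (fromCode x) (cellAct-· g h) ⟩
      relabel (fromCode x) (cellAct (g · h))                 ∎)
      where open ≡-Reasoning

    ⊙-toVec : ∀ g B → g ⊙ toCode (toVec B) ≡ toCode (toVec (gridAct g B))
    ⊙-toVec g B = cong toCode (trans (cong (λ v → relabel v (cellAct g)) (fromCode-toCode (toVec B))) (sym (toVec-gridAct g B)))

    open Burnside _⊙_ ⊙-ε ⊙-· public

    hasWeight : Fin (2 ^ (m * n)) → Bool
    hasWeight x = does (weight (fromCode {m * n} x) ≟ r)

    hasWeight-⊙ : ∀ g x → hasWeight (g ⊙ x) ≡ hasWeight x
    hasWeight-⊙ g x = cong (λ w → does (w ≟ r))
      (trans (cong weight (fromCode-toCode (relabel (fromCode x) (cellAct g)))) (weight-relabel (cellPermutation g) (fromCode x)))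

    fixedPoints : ∀ g → count (λ x → hasWeight x ∧ does (g ⊙ x ≟ᶠ x)) ≡ invariantColourings (m * n) (cellAct g) r
    fixedPoints g = trans (sym (∑ᵛ-toCode (m * n) (λ x → 𝟙 (hasWeight x ∧ does (g ⊙ x ≟ᶠ x))))) (∑ᵛ-cong (m * n) (λ v →
      cong₂ (λ w b → 𝟙 (does (weight {m * n} w ≟ r) ∧ b)) (fromCode-toCode v)
        (trans (cong (λ w → does (toCode (relabel w (cellAct g)) ≟ᶠ toCode v)) (fromCode-toCode v))
               (does-⇔ (mk⇔ toCode-injective (cong toCode))
                       (toCode (relabel v (cellAct g)) ≟ᶠ toCode v) (relabel v (cellAct g) ≟ᵛ v)))))

    isRepresentative : Fin (2 ^ (m * n)) → Bool
    isRepresentative x = hasWeight x ∧ isCanonical x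

    count-representatives : 4 * count isRepresentative ≡ ∑Klein (λ g → invariantColourings (m * n) (cellAct g) r)
    count-representatives = trans (burnside hasWeight hasWeight-⊙) (∑Klein-cong fixedPoints)

    code : Board m n r → Fin (2 ^ (m * n))
    code (B , _) = toCode (toVec B)

    classes : HasNumClasses (_∼_ {m} {n} {r}) (count isRepresentative)
    classes = hasNumClasses-byInvariant _∼_ isRepresentative (canon ∘ code) canon-isRepresentative sound complete onto
      where
      canon-isRepresentative : ∀ b → T (isRepresentative (canon (code b)))
      canon-isRepresentative (B , blocked≡r) = Equivalence.from T-∧
        ( subst T (sym (hasWeight-⊙ (minimiser x) x))
                (Equivalence.from (T-does (weight (fromCode {m * n} x) ≟ r))
                   (trans (cong weight (fromCode-toCode (toVec B))) (trans (weight-toVec B) blocked≡r)))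
        , Equivalence.from (T-does (canon (canon x) ≟ᶠ canon x)) (canon-idempotent x) )
        where
        x : Fin (2 ^ (m * n))
        x = toCode (toVec B)
      sound : ∀ b c → canon (code b) ≡ canon (code c) → b ∼ c
      sound b c eq with canon-orbit (code b) (code c) eq
      ... | g , c≡g⊙b = gridAct⇒∼ {b = b} {c} g (toVec-injective (toCode-injective (trans c≡g⊙b (⊙-toVec g (proj₁ b)))))
      complete : ∀ b c → b ∼ c → canon (code b) ≡ canon (code c)
      complete b c b∼c with ∼⇒gridAct {b = b} {c} b∼c
      ... | g , c≐ = begin
        canon (code b)                                ≡⟨ canon-⊙ g (code b) ⟨
        canon (g ⊙ code b)                            ≡⟨ cong canon (⊙-toVec g (proj₁ b)) ⟩
        canon (toCode (toVec (gridAct g (proj₁ b))))  ≡⟨ cong (canon ∘ toCode) (toVec-cong c≐) ⟨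
        canon (code c)                                ∎
        where open ≡-Reasoning
      onto : ∀ j → T (isRepresentative j) → Σ (Board m n r) (λ b → canon (code b) ≡ j)
      onto j qj = (toGrid (fromCode j) , trans (blockedCount-toGrid (fromCode j)) weight≡r)
                , trans (cong canon (trans (cong toCode (toVec-toGrid (fromCode j))) (toCode-fromCode {m * n} j))) canonical
        where
        weight≡r : weight (fromCode {m * n} j) ≡ r
        weight≡r = Equivalence.to (T-does (weight (fromCode {m * n} j) ≟ r)) (proj₁ (Equivalence.to T-∧ qj))
        canonical : canon j ≡ j
        canonical = Equivalence.to (T-does (canon j ≟ᶠ j)) (proj₂ (Equivalence.to T-∧ qj))

opposite-cycles-even : ∀ k → CycleDecomposition (opposite {2 * k}) (Fin 0) (Fin k)
opposite-cycles-even k = opposite-cycles k 0 (solve 1 (λ k → con 2 :* k := k :+ con 0 :+ k) refl k) (λ ())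

opposite-cycles-odd : ∀ l → CycleDecomposition (opposite {2 * l + 1}) (Fin 1) (Fin l)
opposite-cycles-odd l = opposite-cycles l 1 (solve 1 (λ l → con 2 :* l :+ con 1 := l :+ con 1 :+ l) refl l) (λ { Fin.zero → refl })

module FixedBoards (k l r : ℕ) where
  open Grids (2 * k) (2 * l + 1)

  fixed-R0 : invariantColourings (2 * k * (2 * l + 1)) (cellAct (false , false)) r ≡ (2 * k * (2 * l + 1)) C r
  fixed-R0 = invariantColourings-id _ cellAct-ε r

  fixed-H : invariantColourings (2 * k * (2 * l + 1)) (cellAct (true , false)) r ≡ halfBinom (k * (2 * l + 1)) r
  fixed-H = trans (invariantColourings-cycles (⊗-cycles (opposite-cycles-even k) (id-cycles {Fin (2 * l + 1)})) r)
                  (trans (sumTo-0C r _) (cong (λ p → halfBinom (k * p) r) (+-identityʳ (2 * l + 1))))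

  fixed-V : invariantColourings (2 * k * (2 * l + 1)) (cellAct (false , true)) r
            ≡ sumTo r (λ t → ((2 * k) C t) * halfBinom (2 * k * l) (r ∸ t))
  fixed-V = trans (invariantColourings-cycles (⊗-cycles (id-cycles {Fin (2 * k)}) (opposite-cycles-odd l)) r)
                  (cong₂ (λ f p → sumTo r (λ t → (f C t) * halfBinom p (r ∸ t))) (*-identityʳ (2 * k)) (+-identityʳ (2 * k * l)))

  fixed-R180 : invariantColourings (2 * k * (2 * l + 1)) (cellAct (true , true)) r ≡ halfBinom (k * (2 * l + 1)) r
  fixed-R180 = trans (invariantColourings-cycles (⊗-cycles (opposite-cycles-even k) (opposite-cycles-odd l)) r)
    (trans (sumTo-0C r _) (cong (λ p → halfBinom (k * p) r) (solve 1 (λ l → con 1 :+ (l :+ l) := con 2 :* l :+ con 1) refl l)))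

proposition5p5 : (k l r : ℕ) → 1 ≤ k → 1 ≤ l → 1 ≤ r → r ≤ 2 * k * (2 * l + 1) →
    Σ ℕ (λ N → HasNumClasses (_∼_ {2 * k} {2 * l + 1} {r}) N
      × (4 * N ≡ ((2 * k * (2 * l + 1)) C r) + 2 * halfBinom (k * (2 * l + 1)) r
                 + sumTo r (λ t → ((2 * k) C t) * halfBinom (2 * k * l) (r ∸ t))))
proposition5p5 k l r _ _ _ _ = count isRepresentative , classes , (begin
  4 * count isRepresentative
    ≡⟨ count-representatives ⟩
  ∑Klein (λ g → invariantColourings _ (cellAct g) r)
    ≡⟨ cong₂ _+_ (cong₂ _+_ fixed-R0 fixed-V) (cong₂ _+_ fixed-H fixed-R180) ⟩
  (identity + vertical) + (half + half)
    ≡⟨ solve 3 (λ i v h → (i :+ v) :+ (h :+ h) := i :+ con 2 :* h :+ v) refl identity vertical half ⟩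
  identity + 2 * half + vertical
    ∎)
  where
  open Grids (2 * k) (2 * l + 1)
  open Boards r
  open FixedBoards k l r
  open ≡-Reasoning
  identity half vertical : ℕ
  identity = (2 * k * (2 * l + 1)) C r
  half     = halfBinom (k * (2 * l + 1)) r
  vertical = sumTo r (λ t → ((2 * k) C t) * halfBinom (2 * k * l) (r ∸ t))
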